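{- If $D_1,D_2\in\mathsf{RPD}_{m,n}$ lie in the same connected component of the crystal graph of $\mathsf{RPD}_{m,n}$, then $\bar\sigma_{D_1}=\bar\sigma_{D_2}$.
   Context: Permutations compose as functions and $s_k=(k,k+1)$. $\mathsf{RPD}_{m,n}$ is the set of $n\times m$ arrays (rows $1..n$ top to bottom, columns $1..m$ left to right) of tiles, each a bump tile (pipe from left edge to top edge and pipe from bottom edge to right edge) or a crossing tile. The pipe entering the left of row $r$ is labeled $r$; the pipe entering the bottom of column $j$ is labeled $n+j$. In a bump tile the left label exits at the top and the bottom label exits at the right; in a crossing tile with left label $a$ and bottom label $b$, $\max(a,b)$ exits at the top and $\min(a,b)$ at the right. $\sigma_D\in S_{m+n}$ has one-line notation: top-edge labels left to right, then right-edge labels top to bottom. For $v\in S_n$, $1^m\times v\in S_{m+n}$ fixes each $i\in[m]$ and sends $m+i\mapsto m+v(i)$; $S_n\subseteq S_{m+n}$ as permutations of $\{1,\dots,n\}$. $\bar\sigma_D$ is the unique element of $\{u\sigma_D(1^m\times v^{ -1}):u,v\in S_n\}$ with $\bar\sigma_D^{ -1}(1)>\bar\sigma_D^{ -1}(2)>\dots>\bar\sigma_D^{ -1}(n)$ and $\bar\sigma_D(m+1)>\dots>\bar\sigma_D(m+n)$. Crystal structure: for $T\subseteq[n]$, $\mathrm{wt}(T)=\sum_{j\in T}\mathbf{e}_j$, $e_i(T)=T\cup\{i\}$ if $T\cap\{i,i+1\}=\{i+1\}$, $T\setminus\{i+1\}$ if $T\cap\{i,i+1\}=\{i,i+1\}$,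 else $0$; $f_i(T)=T\cup\{i+1\}$ if $T\cap\{i,i+1\}=\{i\}$, $T\setminus\{i\}$ if $T\cap\{i,i+1\}=\{i,i+1\}$, else $0$. With $\varepsilon_i,\varphi_i$ the maximal number of applications of $e_i,f_i$ before reaching $0$, tensor products have additive weight, $e_i(b\otimes c)=b\otimes e_i(c)$ if $\varepsilon_i(b)\le\varphi_i(c)$ else $e_i(b)\otimes c$, $f_i(b\otimes c)=b\otimes f_i(c)$ if $\varepsilon_i(b)<\varphi_i(c)$ else $f_i(b)\otimes c$, $b\otimes0=0\otimes c=0$. $m$-tuples $(S_1,\dots,S_m)$ of subsets of $[n]$ form a crystal via $S\leftrightarrow S_1\otimes\cdots\otimes S_m$, transported to $\mathsf{RPD}_{m,n}$ via the bijection whose tile in row $r$, column $j$ is a bump tile iff $r\in S_j$. The crystal graph has edges $D\to f_i(D)$ whenever $f_i(D)\ne0$. -}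

module Defs where

open import Data.Nat using (ℕ; zero; suc; _+_; _*_; _∸_; _≤_; _<_; _<ᵇ_; _⊔_; _⊓_)
open import Data.Nat.Properties using (_<?_)
open import Data.Bool using (Bool; true; false; if_then_else_; _∧_; not)
open import Data.Fin using (Fin; toℕ; fromℕ<)
open import Data.Fin.Permutation using (Permutation′; _⟨$⟩ʳ_; flip)
open import Data.Vec using (Vec; []; _∷_)
open import Data.List using (List; []; _∷_; _++_; [_])
open import Data.Maybe using (Maybe; just; nothing)
open import Data.Product using (Σ; _×_; _,_; ∃)
open import Relation.Nullary using (yes; no)
open import Relation.Binary.PropositionalEquality using (_≡_)
open import Relation.Binary.Construct.Closure.Equivalence using (EqClosure)

-- Subsets of [n] as characteristic vectors; positions are 1-based.

Sub : ℕ → Set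
Sub n = Vec Bool n

memb : ∀ {n} → Sub n → ℕ → Bool
memb []       _             = false
memb (b ∷ bs) zero          = false
memb (b ∷ bs) (suc zero)    = b
memb (b ∷ bs) (suc (suc k)) = memb bs (suc k)

setAt : ∀ {n} → Sub n → ℕ → Bool → Sub n
setAt []       _             c = []
setAt (b ∷ bs) zero          c = b ∷ bs
setAt (b ∷ bs) (suc zero)    c = c ∷ bs
setAt (b ∷ bs) (suc (suc k)) c = b ∷ setAt bs (suc k) c

-- Crystal operators on a single subset T ⊆ [n]  (nothing = 0)

eSub : ∀ {n} → ℕ → Sub n → Maybe (Sub n)
eSub i T with memb T i | memb T (suc i)
... | false | true = just (setAt T i true)
... | true  | true = just (setAt T (suc i) false)
... | _     | _    = nothing

fSub : ∀ {n} → ℕ → Sub n → Maybe (Sub n)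
fSub i T with memb T i | memb T (suc i)
... | true | false = just (setAt T (suc i) true)
... | true | true  = just (setAt T i false)
... | _    | _     = nothing

count : ∀ {A : Set} → ℕ → (A → Maybe A) → A → ℕ
count zero    op x = zero
count (suc k) op x with op x
... | nothing = zero
... | just y  = suc (count k op y)

-- Tensor products S₁ ⊗ ⋯ ⊗ S_k, bracketed as S₁ ⊗ (S₂ ⊗ ⋯ ⊗ S_k).
-- ε_i, φ_i of an element of a k-fold tensor product are at most 2k
-- (each e_i (resp. f_i) raises (resp. lowers) wt_i − wt_{i+1} by 1),
-- so counting with fuel 2k+1 computes them exactly.

fuel : ℕ → ℕ
fuel k = suc (2 * k)

eT : ∀ {n} (k : ℕ) → ℕ → Vec (Sub n) k → Maybe (Vec (Sub n) k)
fT : ∀ {n} (k : ℕ) → ℕ → Vec (Sub n) k → Maybe (Vec (Sub n) k)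

eT zero    i []       = nothing
eT (suc k) i (b ∷ c) with count (fuel 1) (eSub i) b Data.Nat.≤ᵇ count (fuel k) (fT k i) c
... | true  with eT k i c
...   | just c' = just (b ∷ c')
...   | nothing = nothing
eT (suc k) i (b ∷ c) | false with eSub i b
...   | just b' = just (b' ∷ c)
...   | nothing = nothing

fT zero    i []       = nothing
fT (suc k) i (b ∷ c) with count (fuel 1) (eSub i) b <ᵇ count (fuel k) (fT k i) c
... | true  with fT k i c
...   | just c' = just (b ∷ c')
...   | nothing = nothing
fT (suc k) i (b ∷ c) | false with fSub i b
...   | just b' = just (b' ∷ c)
...   | nothing = nothing

-- Reduced pipe dreams: D = (S₁,…,S_m), the tile in row r, column j
-- is a bump tile iff r ∈ S_j.

RPD : ℕ → ℕ → Set
RPD m n = Vec (Sub n) m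

Edge : ∀ {m n} → RPD m n → RPD m n → Set
Edge {m} {n} D D′ = Σ ℕ λ i → (1 ≤ i) × (suc i ≤ n) × (fT m i D ≡ just D′)

SameComponent : ∀ {m n} → RPD m n → RPD m n → Set
SameComponent = EqClosure Edge

-- Pipe dynamics.  Labels are natural numbers 1..m+n.

-- pass through one row r from left to right; h = label travelling
-- horizontally, bottoms = labels entering the columns from below.
-- Returns (labels exiting the tops, label exiting the right edge).
rowPass : ∀ {n m} → ℕ → ℕ → RPD m n → Vec ℕ m → Vec ℕ m × ℕ
rowPass r h []       []       = [] , h
rowPass r h (S ∷ D) (b ∷ bs) with memb S r
... | true  with rowPass r b D bs
...   | tops , out = h ∷ tops , out
rowPass r h (S ∷ D) (b ∷ bs) | false with rowPass r (h Data.Nat.⊓ b) D bs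
...   | tops , out = (h Data.Nat.⊔ b) ∷ tops , out

-- process rows k, k-1, …, 1 (bottom to top); returns top-edge labels and
-- the right-edge labels of rows 1..k (top to bottom)
rows : ∀ {n m} → ℕ → RPD m n → Vec ℕ m → Vec ℕ m × List ℕ
rows zero    D bs = bs , []
rows (suc k) D bs with rowPass (suc k) (suc k) D bs
... | bs′ , out with rows k D bs′
...   | tops , rights = tops , rights ++ [ out ]

initBottoms : (n m : ℕ) → Vec ℕ m
initBottoms n zero    = []
initBottoms n (suc m) = suc n ∷ initBottoms (suc n) m

vecToList : ∀ {m} → Vec ℕ m → List ℕ
vecToList []       = []
vecToList (x ∷ xs) = x ∷ vecToList xs

oneLine : ∀ {m n} → RPD m n → List ℕ
oneLine {m} {n} D with rows n D (initBottoms n m)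
... | tops , rights = vecToList tops ++ rights

-- permutations of [N] as functions ℕ → ℕ fixing everything outside [N]
lookupOr : ℕ → List ℕ → ℕ → ℕ
lookupOr d []       _       = d
lookupOr d (x ∷ xs) zero    = x
lookupOr d (x ∷ xs) (suc k) = lookupOr d xs k

σ : ∀ {m n} → RPD m n → ℕ → ℕ
σ D zero    = zero
σ D (suc k) = lookupOr (suc k) (oneLine D) k

-- S_n ⊆ S_{m+n}: permutations of {1,…,n}
emb : ∀ {n} → Permutation′ n → ℕ → ℕ
emb         π zero = zero
emb {n} π (suc k) with k <? n
... | yes p = suc (toℕ (π ⟨$⟩ʳ fromℕ< p))
... | no _  = suc k

oneTimes : ∀ {n} → ℕ → Permutation′ n → ℕ → ℕ
oneTimes m v x with m <? x
... | yes _ = m + emb v (x ∸ m)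
... | no _  = x

-- w is σ̄_D: w ∈ {u σ_D (1^m × v⁻¹)} with the two monotonicity conditions
IsSigmaBar : ∀ {m n} → RPD m n → (ℕ → ℕ) → Set
IsSigmaBar {m} {n} D w =
  (Σ (Permutation′ n) λ u → Σ (Permutation′ n) λ v →
     ∀ x → w x ≡ emb u (σ D (oneTimes m (flip v) x)))
  × -- w⁻¹(1) > w⁻¹(2) > ⋯ > w⁻¹(n)
  (∀ p p′ → 1 ≤ p → p ≤ m + n → 1 ≤ p′ → p′ ≤ m + n →
     1 ≤ w p → w p < w p′ → w p′ ≤ n → p′ < p)
  ×
  (∀ i i′ → 1 ≤ i → i < i′ → i′ ≤ n → w (m + i′) < w (m + i))

module Submission where

-- Replace every row label 1, …, n by 0.  The collapsed labels leaving the top of D record only where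
-- the column pipes n+1, …, n+m exit, and this collapsed top row is invariant under every crystal
-- operator f_i: f_i changes D only in rows i and i+1, and walking through the columns along the
-- signature rule of the tensor product one checks that the collapsed rows i, i+1 send the same
-- labels upward before and after f_i.  On positions 1, …, m the permutation σ̄_D = u σ_D (1^m × v⁻¹)
-- has the same collapsed values as σ_D, and a permutation w with w⁻¹(1) > ⋯ > w⁻¹(n) and
-- w(m+1) > ⋯ > w(m+n) is determined by these collapsed values, by downward induction on the values.

open import Algebra.Properties.CommutativeSemigroup using (x∙yz≈y∙xz)
open import Data.Bool using (Bool; true; false)
open import Data.Empty using (⊥; ⊥-elim)
open import Data.Fin using (toℕ; fromℕ<)
open import Data.Fin.Properties using (toℕ<n; toℕ-fromℕ<; fromℕ<-toℕ; toℕ-injective)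
open import Data.Fin.Permutation using (Permutation′; _⟨$⟩ʳ_; _⟨$⟩ˡ_; inverseˡ; inverseʳ; flip)
open import Data.List using (List; []; _∷_; _++_; [_]; length; applyDownFrom)
import Data.List.Properties as List
open import Data.List.Membership.Propositional using (_∈_)
open import Data.List.Membership.Propositional.Properties
  using (∈-++⁻; ∈-++⁺ˡ; ∈-++⁺ʳ; ∈-applyDownFrom⁺; ∈-applyDownFrom⁻)
open import Data.List.Relation.Unary.Any using (here; there)
import Data.List.Relation.Unary.All as All
open import Data.List.Relation.Unary.AllPairs using ([]; _∷_)
open import Data.List.Relation.Unary.Unique.Propositional using (Unique)
import Data.List.Relation.Unary.Unique.Propositional.Properties as Unique
open import Data.List.Relation.Binary.Permutation.Propositional
  using (_↭_; ↭-refl; ↭-reflexive; ↭-sym; ↭-trans; ↭-prep; ↭-swap; ↭⇒↭ₛ)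
open import Data.List.Relation.Binary.Permutation.Propositional.Properties
  using (∈-resp-↭; ↭-length; ++⁺ʳ; shift; ∷↭∷ʳ)
open import Data.Maybe using (Maybe; just; nothing)
import Data.Maybe as Maybe
open import Data.Maybe.Properties using (just-injective)
open import Data.Nat
open import Data.Nat.Properties
open import Data.Product using (∃; ∃₂; _×_; _,_; proj₁; proj₂; map₁)
import Data.Product as Product
open import Data.Sum using (_⊎_; inj₁; inj₂; fromInj₁)
open import Data.Vec using (Vec; []; _∷_)
import Data.Vec as Vec
open import Data.Vec.Properties using (∷-injectiveˡ; ∷-injectiveʳ)
open import Function using (_∘_)
open import Relation.Binary.Core using (_Preserves_⟶_)
open import Relation.Binary.Definitions using (tri<; tri≈; tri>)
open import Relation.Binary.PropositionalEquality
  using (_≡_; _≢_; _≗_; refl; sym; trans; cong; cong₂; subst; subst₂; isEquivalence; setoid; module ≡-Reasoning)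
open import Relation.Binary.Construct.Closure.Equivalence using (gfold)
open import Data.List.Relation.Binary.Permutation.Setoid.Properties (setoid ℕ) using (Unique-resp-↭)
open import Relation.Nullary using (¬_; yes; no; contradiction)
open import Relation.Nullary.Reflects using (ofʸ; ofⁿ)

open import Defs

open ≡-Reasoning

⊔-exchange : ∀ x y z → x ⊔ (y ⊔ z) ≡ y ⊔ (x ⊔ z)
⊔-exchange = x∙yz≈y∙xz ⊔-commutativeSemigroup

⊓-exchange : ∀ x y z → x ⊓ (y ⊓ z) ≡ y ⊓ (x ⊓ z)
⊓-exchange = x∙yz≈y∙xz ⊓-commutativeSemigroup

⊓-⊔-absorb-⊓ : ∀ x y c → (x ⊓ (y ⊔ c)) ⊓ (y ⊓ c) ≡ x ⊓ (y ⊓ c)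
⊓-⊔-absorb-⊓ x y c = trans (⊓-assoc x (y ⊔ c) (y ⊓ c)) (cong (x ⊓_) (m≥n⇒m⊓n≡n (m⊓n≤m⊔n y c)))

median-swap : ∀ x y c → (x ⊓ (y ⊔ c)) ⊔ (y ⊓ c) ≡ (y ⊓ (x ⊔ c)) ⊔ (x ⊓ c)
median-swap x y c = begin
  (x ⊓ (y ⊔ c)) ⊔ (y ⊓ c)         ≡⟨ cong (_⊔ (y ⊓ c)) (⊓-distribˡ-⊔ x y c) ⟩
  ((x ⊓ y) ⊔ (x ⊓ c)) ⊔ (y ⊓ c)   ≡⟨ ⊔-assoc (x ⊓ y) (x ⊓ c) (y ⊓ c) ⟩
  (x ⊓ y) ⊔ ((x ⊓ c) ⊔ (y ⊓ c))   ≡⟨ cong₂ _⊔_ (⊓-comm x y) (⊔-comm (x ⊓ c) (y ⊓ c)) ⟩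
  (y ⊓ x) ⊔ ((y ⊓ c) ⊔ (x ⊓ c))   ≡⟨ ⊔-assoc (y ⊓ x) (y ⊓ c) (x ⊓ c) ⟨
  ((y ⊓ x) ⊔ (y ⊓ c)) ⊔ (x ⊓ c)   ≡⟨ cong (_⊔ (x ⊓ c)) (⊓-distribˡ-⊔ y x c) ⟨
  (y ⊓ (x ⊔ c)) ⊔ (x ⊓ c)         ∎

minimum-swap : ∀ x y c → (x ⊓ (y ⊔ c)) ⊓ (y ⊓ c) ≡ (y ⊓ (x ⊔ c)) ⊓ (x ⊓ c)
minimum-swap x y c = begin
  (x ⊓ (y ⊔ c)) ⊓ (y ⊓ c)   ≡⟨ ⊓-⊔-absorb-⊓ x y c ⟩
  x ⊓ (y ⊓ c)               ≡⟨ ⊓-exchange x y c ⟩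
  y ⊓ (x ⊓ c)               ≡⟨ ⊓-⊔-absorb-⊓ y x c ⟨
  (y ⊓ (x ⊔ c)) ⊓ (x ⊓ c)   ∎

module _ {A : Set} {g : ℕ → ℕ → A} (g-comm : ∀ x y → g x y ≡ g y x) where

  comm-⊔-⊓ : ∀ x y → g (x ⊔ y) (x ⊓ y) ≡ g x y
  comm-⊔-⊓ x y with ≤-total x y
  ... | inj₁ x≤y rewrite m≤n⇒m⊔n≡n x≤y | m≤n⇒m⊓n≡m x≤y = g-comm y x
  ... | inj₂ y≤x rewrite m≥n⇒m⊔n≡m y≤x | m≥n⇒m⊓n≡n y≤x = refl

  -- Both pairs of arguments are the middle and the smallest of x, y, c.
  comm-median : ∀ x y c → g (x ⊓ (y ⊔ c)) (y ⊓ c) ≡ g (y ⊓ (x ⊔ c)) (x ⊓ c)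
  comm-median x y c = begin
    g (x ⊓ (y ⊔ c)) (y ⊓ c)                               ≡⟨ comm-⊔-⊓ _ _ ⟨
    g ((x ⊓ (y ⊔ c)) ⊔ (y ⊓ c)) ((x ⊓ (y ⊔ c)) ⊓ (y ⊓ c)) ≡⟨ cong₂ g (median-swap x y c) (minimum-swap x y c) ⟩
    g ((y ⊓ (x ⊔ c)) ⊔ (x ⊓ c)) ((y ⊓ (x ⊔ c)) ⊓ (x ⊓ c)) ≡⟨ comm-⊔-⊓ _ _ ⟩
    g (y ⊓ (x ⊔ c)) (x ⊓ c)                               ∎

map-≡-just : ∀ {A B : Set} (f : A → B) (x : Maybe A) {y} → Maybe.map f x ≡ just y → ∃ λ x′ → x ≡ just x′ × f x′ ≡ y
map-≡-just f (just x′) refl = x′ , refl , refl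

map-≡-nothing : ∀ {A B : Set} {f : A → B} {x : Maybe A} → Maybe.map f x ≡ nothing → x ≡ nothing
map-≡-nothing {x = nothing} refl = refl

AppliesTwice : ∀ {A : Set} → (A → Maybe A) → A → Set
AppliesTwice op x = ∃₂ λ y z → op x ≡ just y × op y ≡ just z

module _ {A : Set} (op : A → Maybe A) where

  count-just : ∀ F {x y} → op x ≡ just y → count (suc F) op x ≡ suc (count F op y)
  count-just F eq rewrite eq = refl

  count-nothing : ∀ F {x} → op x ≡ nothing → count F op x ≡ 0
  count-nothing zero    _  = refl
  count-nothing (suc F) eq rewrite eq = refl

  count≤0⇒nothing : ∀ F {x} → count (suc F) op x ≤ 0 → op x ≡ nothing
  count≤0⇒nothing F {x} _ with op x
  ... | nothing = refl

  count>0⇒just : ∀ F {x} → 0 < count F op x → ∃ λ y → op x ≡ just y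
  count>0⇒just (suc F) {x} _ with op x
  ... | just y = y , refl

  count≥2⇒twice : ∀ F {x} → 2 ≤ count F op x → AppliesTwice op x
  count≥2⇒twice (suc F) {x} 2≤c with op x
  ... | just y = let z , ey = count>0⇒just F (s≤s⁻¹ 2≤c) in y , z , refl , ey

memb-setAt-≡ : ∀ {n} (T : Sub n) {k} b → 1 ≤ k → k ≤ n → memb (setAt T k b) k ≡ b
memb-setAt-≡ (_ ∷ _) {suc zero}    b _ _         = refl
memb-setAt-≡ (_ ∷ T) {suc (suc k)} b _ (s≤s k<n) = memb-setAt-≡ T b z<s k<n

memb-setAt-≢ : ∀ {n} (T : Sub n) {k k′} b → k ≢ k′ → memb (setAt T k b) k′ ≡ memb T k′
memb-setAt-≢ []      b _ = refl
memb-setAt-≢ (_ ∷ T) {zero}                       b _    = refl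
memb-setAt-≢ (_ ∷ T) {suc zero}    {zero}         b _    = refl
memb-setAt-≢ (_ ∷ T) {suc zero}    {suc zero}     b k≢k  = contradiction refl k≢k
memb-setAt-≢ (_ ∷ T) {suc zero}    {suc (suc _)}  b _    = refl
memb-setAt-≢ (_ ∷ T) {suc (suc k)} {zero}         b _    = refl
memb-setAt-≢ (_ ∷ T) {suc (suc k)} {suc zero}     b _    = refl
memb-setAt-≢ (_ ∷ T) {suc (suc k)} {suc (suc k′)} b k≢k′ = memb-setAt-≢ T b (k≢k′ ∘ cong suc)

-- Pipe dynamics

row : ∀ {k n} → ℕ → RPD k n → Vec Bool k
row r = Vec.map (λ S → memb S r)

-- (label leaving at the top, label leaving to the right) of a bump (true) or crossing (false) tile
tile : Bool → ℕ → ℕ → ℕ × ℕ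
tile true  h b = h , b
tile false h b = h ⊔ b , h ⊓ b

rowPass-∷ : ∀ {n k} r h (S : Sub n) (D : RPD k n) b bs →
  rowPass r h (S ∷ D) (b ∷ bs) ≡ (let top , h′ = tile (memb S r) h b in map₁ (top ∷_) (rowPass r h′ D bs))
rowPass-∷ r h S D b bs with memb S r
... | true  with rowPass r b D bs
...   | _ , _ = refl
rowPass-∷ r h S D b bs | false with rowPass r (h ⊓ b) D bs
...   | _ , _ = refl

rowPass-row : ∀ {n k} r h {D D′ : RPD k n} bs → row r D ≡ row r D′ → rowPass r h D bs ≡ rowPass r h D′ bs
rowPass-row r h {[]}    {[]}      []       _  = refl
rowPass-row r h {S ∷ D} {S′ ∷ D′} (b ∷ bs) eq
  rewrite rowPass-∷ r h S D b bs | rowPass-∷ r h S′ D′ b bs | ∷-injectiveˡ eq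
  = cong (map₁ (proj₁ (tile (memb S′ r) h b) ∷_)) (rowPass-row r _ bs (∷-injectiveʳ eq))

module _ {f : ℕ → ℕ} (f-mono : f Preserves _≤_ ⟶ _≤_) where

  tile-map : ∀ β h b → tile β (f h) (f b) ≡ Product.map f f (tile β h b)
  tile-map true  h b = refl
  tile-map false h b = sym (cong₂ _,_ (mono-≤-distrib-⊔ f-mono h b) (mono-≤-distrib-⊓ f-mono h b))

  rowPass-map : ∀ {n k} r h (D : RPD k n) bs →
    rowPass r (f h) D (Vec.map f bs) ≡ Product.map (Vec.map f) f (rowPass r h D bs)
  rowPass-map r h []      []       = refl
  rowPass-map r h (S ∷ D) (b ∷ bs) = begin
    rowPass r (f h) (S ∷ D) (f b ∷ Vec.map f bs)
      ≡⟨ rowPass-∷ r (f h) S D (f b) (Vec.map f bs) ⟩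
    map₁ (proj₁ (tile β (f h) (f b)) ∷_) (rowPass r (proj₂ (tile β (f h) (f b))) D (Vec.map f bs))
      ≡⟨ cong (λ p → map₁ (proj₁ p ∷_) (rowPass r (proj₂ p) D (Vec.map f bs))) (tile-map β h b) ⟩
    map₁ (f top ∷_) (rowPass r (f h′) D (Vec.map f bs))
      ≡⟨ cong (map₁ (f top ∷_)) (rowPass-map r h′ D bs) ⟩
    Product.map (Vec.map f) f (map₁ (top ∷_) (rowPass r h′ D bs))
      ≡⟨ cong (Product.map (Vec.map f) f) (rowPass-∷ r h S D b bs) ⟨
    Product.map (Vec.map f) f (rowPass r h (S ∷ D) (b ∷ bs))
      ∎
    where
    β = memb S r
    top = proj₁ (tile β h b)
    h′ = proj₂ (tile β h b)

rows-suc : ∀ {m n} k (D : RPD m n) bs → rows (suc k) D bs ≡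
  (let bs′ , out = rowPass (suc k) (suc k) D bs ; tops , rights = rows k D bs′ in tops , rights ++ [ out ])
rows-suc k D bs with rowPass (suc k) (suc k) D bs
... | bs′ , out with rows k D bs′
...   | _ , _ = refl

oneLine-rows : ∀ {m n} (D : RPD m n) →
  oneLine D ≡ (let tops , rights = rows n D (initBottoms n m) in vecToList tops ++ rights)
oneLine-rows {m} {n} D with rows n D (initBottoms n m)
... | _ , _ = refl

tile-↭ : ∀ β h b (xs : List ℕ) → (let top , right = tile β h b in top ∷ right ∷ xs) ↭ h ∷ b ∷ xs
tile-↭ true  h b xs = ↭-refl
tile-↭ false h b xs with ≤-total h b
... | inj₁ h≤b rewrite m≤n⇒m⊔n≡n h≤b | m≤n⇒m⊓n≡m h≤b = ↭-swap b h ↭-refl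
... | inj₂ b≤h rewrite m≥n⇒m⊔n≡m b≤h | m≥n⇒m⊓n≡n b≤h = ↭-refl

rowPass-↭ : ∀ {n k} r h (D : RPD k n) bs →
  (let tops , out = rowPass r h D bs in out ∷ vecToList tops) ↭ h ∷ vecToList bs
rowPass-↭ r h []      []       = ↭-refl
rowPass-↭ r h (S ∷ D) (b ∷ bs) rewrite rowPass-∷ r h S D b bs =
  ↭-trans (↭-swap _ _ ↭-refl)
  (↭-trans (↭-prep _ (rowPass-↭ r (proj₂ (tile (memb S r) h b)) D bs))
           (tile-↭ (memb S r) h b (vecToList bs)))

rows-↭ : ∀ {m n} k (D : RPD m n) bs →
  (let tops , rights = rows k D bs in vecToList tops ++ rights) ↭ vecToList bs ++ applyDownFrom suc k
rows-↭ zero    D bs = ↭-refl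
rows-↭ (suc k) D bs rewrite rows-suc k D bs =
  ↭-trans (↭-reflexive (sym (List.++-assoc (vecToList tops) rights [ out ])))
  (↭-trans (↭-sym (∷↭∷ʳ out (vecToList tops ++ rights)))
  (↭-trans (↭-prep out (rows-↭ k D bs′))
  (↭-trans (++⁺ʳ (applyDownFrom suc k) (rowPass-↭ (suc k) (suc k) D bs))
           (↭-sym (shift (suc k) (vecToList bs) (applyDownFrom suc k))))))
  where
  bs′ = proj₁ (rowPass (suc k) (suc k) D bs)
  out = proj₂ (rowPass (suc k) (suc k) D bs)
  tops = proj₁ (rows k D bs′)
  rights = proj₂ (rows k D bs′)

enteringLabels : ℕ → ℕ → List ℕ
enteringLabels m n = vecToList (initBottoms n m) ++ applyDownFrom suc n

oneLine-↭ : ∀ {m n} (D : RPD m n) → oneLine D ↭ enteringLabels m n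
oneLine-↭ {m} {n} D = subst (_↭ _) (sym (oneLine-rows D)) (rows-↭ n D (initBottoms n m))

sweep : ∀ {m n} → ℕ → RPD m n → Vec ℕ m → Vec ℕ m
sweep zero    D bs = bs
sweep (suc k) D bs = sweep k D (proj₁ (rowPass (suc k) 0 D bs))

sweep-extend : ∀ {m n k l} {D D′ : RPD m n} → k ≤′ l → (∀ {r} → k < r → r ≤ l → row r D ≡ row r D′) →
  (∀ bs → sweep k D bs ≡ sweep k D′ bs) → ∀ bs → sweep l D bs ≡ sweep l D′ bs
sweep-extend ≤′-refl _ sweep-k≡ = sweep-k≡
sweep-extend {l = suc l} (≤′-step k≤′l) rows≡ sweep-k≡ bs
  rewrite rowPass-row (suc l) 0 bs (rows≡ (s≤s (≤′⇒≤ k≤′l)) ≤-refl)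
  = sweep-extend k≤′l (λ k<r r≤l → rows≡ k<r (m≤n⇒m≤1+n r≤l)) sweep-k≡ _

twoRows : ∀ {n k} → ℕ → ℕ → ℕ → RPD k n → Vec ℕ k → Vec ℕ k
twoRows i a b D cs = proj₁ (rowPass i a D (proj₁ (rowPass (suc i) b D cs)))

sweep-twoRows : ∀ {m n i} → 1 ≤ i → (D : RPD m n) → ∀ bs →
  sweep (suc i) D bs ≡ sweep (pred i) D (twoRows i 0 0 D bs)
sweep-twoRows {i = suc _} _ D bs = refl

columnStep : Bool → Bool → ℕ → ℕ → ℕ → ℕ × ℕ × ℕ
columnStep α β a b c = let up , b′ = tile β b c ; top , a′ = tile α a up in top , a′ , b′

twoRows-∷ : ∀ {n k i} (S : Sub n) (D : RPD k n) {α β a b c cs} → memb S i ≡ α → memb S (suc i) ≡ β →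
  twoRows i a b (S ∷ D) (c ∷ cs) ≡ (let top , a′ , b′ = columnStep α β a b c in top ∷ twoRows i a′ b′ D cs)
twoRows-∷ {i = i} S D {a = a} {b} {c} {cs} refl refl =
  trans (cong (λ p → proj₁ (rowPass i a (S ∷ D) (proj₁ p))) (rowPass-∷ (suc i) b S D c cs))
        (cong proj₁ (rowPass-∷ i a S D _ _))

twoRows-∷-cong : ∀ {n k i} (S : Sub n) {t t′ : RPD k n} {α β a b c cs} → memb S i ≡ α → memb S (suc i) ≡ β →
  (let _ , a′ , b′ = columnStep α β a b c in twoRows i a′ b′ t cs ≡ twoRows i a′ b′ t′ cs) →
  twoRows i a b (S ∷ t) (c ∷ cs) ≡ twoRows i a b (S ∷ t′) (c ∷ cs)
twoRows-∷-cong S {t} {t′} e₁ e₂ eq =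
  trans (twoRows-∷ S t e₁ e₂) (trans (cong (_ ∷_) eq) (sym (twoRows-∷ S t′ e₁ e₂)))

-- The crystal operator f_i

module _ {n : ℕ} (i : ℕ) where

  data ColumnView (S : Sub n) : Set where
    ∈∈ : memb S i ≡ true  → memb S (suc i) ≡ true  → ColumnView S
    ∈∉ : memb S i ≡ true  → memb S (suc i) ≡ false → ColumnView S
    ∉∈ : memb S i ≡ false → memb S (suc i) ≡ true  → ColumnView S
    ∉∉ : memb S i ≡ false → memb S (suc i) ≡ false → ColumnView S

  columnView : (S : Sub n) → ColumnView S
  columnView S with memb S i in e₁ | memb S (suc i) in e₂
  ... | true  | true  = ∈∈ e₁ e₂
  ... | true  | false = ∈∉ e₁ e₂
  ... | false | true  = ∉∈ e₁ e₂
  ... | false | false = ∉∉ e₁ e₂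

  ε : Sub n → ℕ
  ε = count (fuel 1) (eSub i)

  φ : ∀ {k} → RPD k n → ℕ
  φ {k} = count (fuel k) (fT k i)

  fT-∷-tail : ∀ {k} S (t : RPD k n) → ε S < φ t → fT (suc k) i (S ∷ t) ≡ Maybe.map (S ∷_) (fT k i t)
  fT-∷-tail {k} S t ε<φ
    with count (fuel 1) (eSub i) S <ᵇ count (fuel k) (fT k i) t | <ᵇ-reflects-< (ε S) (φ t)
  ... | false | ofⁿ ε≮φ = contradiction ε<φ ε≮φ
  ... | true  | _ with fT k i t
  ...   | just _  = refl
  ...   | nothing = refl

  fT-∷-head : ∀ {k} S (t : RPD k n) → φ t ≤ ε S → fT (suc k) i (S ∷ t) ≡ Maybe.map (_∷ t) (fSub i S)
  fT-∷-head {k} S t φ≤ε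
    with count (fuel 1) (eSub i) S <ᵇ count (fuel k) (fT k i) t | <ᵇ-reflects-< (ε S) (φ t)
  ... | true  | ofʸ ε<φ = contradiction φ≤ε (<⇒≱ ε<φ)
  ... | false | _ with fSub i S
  ...   | just _  = refl
  ...   | nothing = refl

  eSub-∉ : ∀ (S : Sub n) → memb S (suc i) ≡ false → eSub i S ≡ nothing
  eSub-∉ S _ with memb S i | memb S (suc i)
  ... | true  | false = refl
  ... | false | false = refl

  fSub-∉ : ∀ (S : Sub n) → memb S i ≡ false → fSub i S ≡ nothing
  fSub-∉ S _ with memb S i | memb S (suc i)
  ... | false | true  = refl
  ... | false | false = refl

  fSub-∈ : ∀ (S : Sub n) → memb S i ≡ true → ∃ λ S′ → fSub i S ≡ just S′
  fSub-∈ S _ with memb S i | memb S (suc i)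
  ... | true | true  = _ , refl
  ... | true | false = _ , refl

  fSub-other-rows : ∀ {S S′ : Sub n} {r} → fSub i S ≡ just S′ → r ≢ i → r ≢ suc i → memb S′ r ≡ memb S r
  fSub-other-rows {S} fS r≢i r≢1+i with memb S i | memb S (suc i)
  fSub-other-rows {S} refl r≢i r≢1+i | true | false = memb-setAt-≢ S true (r≢1+i ∘ sym)
  fSub-other-rows {S} refl r≢i r≢1+i | true | true  = memb-setAt-≢ S false (r≢i ∘ sym)

  ε-∉ : ∀ (S : Sub n) → memb S (suc i) ≡ false → ε S ≡ 0
  ε-∉ S e = count-nothing (eSub i) (fuel 1) (eSub-∉ S e)

  fT-dead : ∀ {k} (t : RPD k n) → φ t ≤ 0 → fT k i t ≡ nothing
  fT-dead {k} t = count≤0⇒nothing (fT k i) (2 * k)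

  fT-∷-∈ : ∀ {k} S (t : RPD k n) → memb S i ≡ true → ∃ λ D′ → fT (suc k) i (S ∷ t) ≡ just D′
  fT-∷-∈ {k} S t e with ε S <? φ t
  ... | yes ε<φ = let t′ , ft = count>0⇒just (fT k i) (fuel k) (≤-<-trans z≤n ε<φ) in
                  S ∷ t′ , trans (fT-∷-tail S t ε<φ) (cong (Maybe.map (S ∷_)) ft)
  ... | no ε≮φ  = let S′ , fS = fSub-∈ S e in
                  S′ ∷ t , trans (fT-∷-head S t (≮⇒≥ ε≮φ)) (cong (Maybe.map (_∷ t)) fS)

  fT-∷-∉∉ : ∀ {k} S (t : RPD k n) → memb S i ≡ false → memb S (suc i) ≡ false →
    fT (suc k) i (S ∷ t) ≡ Maybe.map (S ∷_) (fT k i t)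
  fT-∷-∉∉ {k} S t e₁ e₂ with ε S <? φ t
  ... | yes ε<φ = fT-∷-tail S t ε<φ
  ... | no ε≮φ  = begin
    fT (suc k) i (S ∷ t)          ≡⟨ fT-∷-head S t (≮⇒≥ ε≮φ) ⟩
    Maybe.map (_∷ t) (fSub i S)   ≡⟨ cong (Maybe.map (_∷ t)) (fSub-∉ S e₁) ⟩
    nothing                       ≡⟨ cong (Maybe.map (S ∷_)) (fT-dead t (subst (φ t ≤_) (ε-∉ S e₂) (≮⇒≥ ε≮φ))) ⟨
    Maybe.map (S ∷_) (fT k i t)   ∎

  fT-row : ∀ {k r} {D D′ : RPD k n} → fT k i D ≡ just D′ → r ≢ i → r ≢ suc i → row r D′ ≡ row r D
  fT-row {D = S ∷ t} fD r≢i r≢1+i with ε S <? φ t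
  ... | yes ε<φ with map-≡-just (S ∷_) (fT _ i t) (trans (sym (fT-∷-tail S t ε<φ)) fD)
  ...   | _ , ft , refl = cong (memb S _ ∷_) (fT-row ft r≢i r≢1+i)
  fT-row {D = S ∷ t} fD r≢i r≢1+i | no ε≮φ
    with map-≡-just (_∷ t) (fSub i S) (trans (sym (fT-∷-head S t (≮⇒≥ ε≮φ))) fD)
  ... | _ , fS , refl = cong (_∷ row _ t) (fSub-other-rows fS r≢i r≢1+i)

  twice-tail : ∀ {k} S (t : RPD k n) {j} → ε S ≡ suc j → ε S < φ t → AppliesTwice (fT k i) t
  twice-tail {k} S t εS≡1+j ε<φ =
    count≥2⇒twice (fT k i) (fuel k) (≤-trans (subst (λ e → 2 ≤ suc e) (sym εS≡1+j) (s≤s (s≤s z≤n))) ε<φ)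

  sorted-or-twice-∉∉ : ∀ {k} S (t : RPD k n) {t′ a b c} → memb S i ≡ false → memb S (suc i) ≡ false →
    fT k i t ≡ just t′ → b ≤ a ⊎ AppliesTwice (fT (suc k) i) (S ∷ t) →
    b ⊓ c ≤ a ⊓ (b ⊔ c) ⊎ AppliesTwice (fT k i) t
  sorted-or-twice-∉∉ S t {b = b} {c} _ _ _ (inj₁ b≤a) = inj₁ (⊓-glb (≤-trans (m⊓n≤m b c) b≤a) (m⊓n≤m⊔n b c))
  sorted-or-twice-∉∉ {k} S t {t′} e₁ e₂ ft (inj₂ (_ , _ , fD , fD′))
    with just-injective (trans (sym fD) (trans (fT-∷-∉∉ S t e₁ e₂) (cong (Maybe.map (S ∷_)) ft)))
  ... | refl = let t″ , ft′ , _ = map-≡-just (S ∷_) (fT k i t′) (trans (sym (fT-∷-∉∉ S t′ e₁ e₂)) fD′) in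
               inj₂ (t′ , t″ , ft , ft′)

  module _ (1≤i : 1 ≤ i) (i<n : suc i ≤ n) where

    private
      i≤n : i ≤ n
      i≤n = <⇒≤ i<n

    count-∈∈ : ∀ F {S : Sub n} → memb S i ≡ true → memb S (suc i) ≡ true → count (suc F) (eSub i) S ≡ 1
    count-∈∈ F {S} e₁ e₂ = begin
      count (suc F) (eSub i) S                         ≡⟨ count-just (eSub i) F eS ⟩
      suc (count F (eSub i) (setAt S (suc i) false))   ≡⟨ cong suc (count-nothing (eSub i) F (eSub-∉ _ i+1∉)) ⟩
      1                                                ∎
      where
      eS : eSub i S ≡ just (setAt S (suc i) false)
      eS with memb S i | memb S (suc i)
      eS | true | true = refl
      i+1∉ = memb-setAt-≡ S false z<s i<n

    ε-∈∈ : ∀ {S : Sub n} → memb S i ≡ true → memb S (suc i) ≡ true → ε S ≡ 1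
    ε-∈∈ = count-∈∈ 2

    ε-∉∈ : ∀ {S : Sub n} → memb S i ≡ false → memb S (suc i) ≡ true → ε S ≡ 2
    ε-∉∈ {S} e₁ e₂ = begin
      count 3 (eSub i) S                        ≡⟨ count-just (eSub i) 2 eS ⟩
      suc (count 2 (eSub i) (setAt S i true))   ≡⟨ cong suc (count-∈∈ 1 i∈ i+1∈) ⟩
      2                                         ∎
      where
      eS : eSub i S ≡ just (setAt S i true)
      eS with memb S i | memb S (suc i)
      eS | false | true = refl
      i∈ = memb-setAt-≡ S true 1≤i i≤n
      i+1∈ = trans (memb-setAt-≢ S true (<⇒≢ (n<1+n i))) e₂

    fSub-∈∉ : ∀ {S S′ : Sub n} → fSub i S ≡ just S′ → memb S i ≡ true → memb S (suc i) ≡ false →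
      memb S′ i ≡ true × memb S′ (suc i) ≡ true
    fSub-∈∉ {S} fS e₁ e₂ with just-injective (trans (sym fS′) fS)
      where
      fS′ : fSub i S ≡ just (setAt S (suc i) true)
      fS′ with memb S i | memb S (suc i)
      fS′ | true | false = refl
    ... | refl = trans (memb-setAt-≢ S true 1+n≢n) e₁ , memb-setAt-≡ S true z<s i<n

    fSub-∈∈ : ∀ {S S′ : Sub n} → fSub i S ≡ just S′ → memb S i ≡ true → memb S (suc i) ≡ true →
      memb S′ i ≡ false × memb S′ (suc i) ≡ true
    fSub-∈∈ {S} fS e₁ e₂ with just-injective (trans (sym fS′) fS)
      where
      fS′ : fSub i S ≡ just (setAt S i false)
      fS′ with memb S i | memb S (suc i)
      fS′ | true | true = refl
    ... | refl = memb-setAt-≡ S false 1≤i i≤n , trans (memb-setAt-≢ S false (<⇒≢ (n<1+n i))) e₂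

    fT-stuck-after-∈∈ : ∀ {k} {S S′} {t : RPD k n} → fSub i S ≡ just S′ → memb S i ≡ true → memb S (suc i) ≡ true →
      φ t ≤ ε S → fT (suc k) i (S′ ∷ t) ≡ nothing
    fT-stuck-after-∈∈ {S′ = S′} {t} fS e₁ e₂ φ≤ε = begin
      fT _ i (S′ ∷ t)                ≡⟨ fT-∷-head S′ t (≤-trans φ≤ε (≤-trans (≤-reflexive (ε-∈∈ e₁ e₂)) 1≤ε′)) ⟩
      Maybe.map (_∷ t) (fSub i S′)   ≡⟨ cong (Maybe.map (_∷ t)) (fSub-∉ S′ e₁′) ⟩
      nothing                        ∎
      where
      e₁′ = proj₁ (fSub-∈∈ fS e₁ e₂)
      1≤ε′ : 1 ≤ ε S′
      1≤ε′ = subst (1 ≤_) (sym (ε-∉∈ e₁′ (proj₂ (fSub-∈∈ fS e₁ e₂)))) (s≤s z≤n)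

    twoRows-comm : ∀ {k} (t : RPD k n) → fT k i t ≡ nothing → ∀ x y cs →
      twoRows i x y t cs ≡ twoRows i y x t cs
    twoRows-comm []      _    x y []       = refl
    twoRows-comm (S ∷ t) dead x y (c ∷ cs) with columnView S
    ... | ∈∈ e₁ _  = contradiction (trans (sym (proj₂ (fT-∷-∈ S t e₁))) dead) λ ()
    ... | ∈∉ e₁ _  = contradiction (trans (sym (proj₂ (fT-∷-∈ S t e₁))) dead) λ ()
    ... | ∉∈ e₁ e₂ = begin
      twoRows i x y (S ∷ t) (c ∷ cs)       ≡⟨ twoRows-∷ S t e₁ e₂ ⟩
      (x ⊔ y) ∷ twoRows i (x ⊓ y) c t cs
        ≡⟨ cong₂ (λ u v → u ∷ twoRows i v c t cs) (⊔-comm x y) (⊓-comm x y) ⟩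
      (y ⊔ x) ∷ twoRows i (y ⊓ x) c t cs   ≡⟨ twoRows-∷ S t e₁ e₂ ⟨
      twoRows i y x (S ∷ t) (c ∷ cs)       ∎
    ... | ∉∉ e₁ e₂ = begin
      twoRows i x y (S ∷ t) (c ∷ cs)                         ≡⟨ twoRows-∷ S t e₁ e₂ ⟩
      (x ⊔ (y ⊔ c)) ∷ twoRows i (x ⊓ (y ⊔ c)) (y ⊓ c) t cs
        ≡⟨ cong₂ _∷_ (⊔-exchange x y c) (comm-median tail-comm x y c) ⟩
      (y ⊔ (x ⊔ c)) ∷ twoRows i (y ⊓ (x ⊔ c)) (x ⊓ c) t cs   ≡⟨ twoRows-∷ S t e₁ e₂ ⟨
      twoRows i y x (S ∷ t) (c ∷ cs)                         ∎
      where
      tail-comm : ∀ a b → twoRows i a b t cs ≡ twoRows i b a t cs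
      tail-comm a b = twoRows-comm t (map-≡-nothing (trans (sym (fT-∷-∉∉ S t e₁ e₂)) dead)) a b cs

    twoRows-fSub : ∀ {k} {S S′} {t : RPD k n} {c cs a b} → fSub i S ≡ just S′ → φ t ≤ ε S →
      fT (suc k) i (S ∷ t) ≡ just (S′ ∷ t) → b ≤ a ⊎ AppliesTwice (fT (suc k) i) (S ∷ t) →
      twoRows i a b (S ∷ t) (c ∷ cs) ≡ twoRows i a b (S′ ∷ t) (c ∷ cs)
    twoRows-fSub {S = S} fS _ _ _ with columnView S
    ... | ∉∈ e₁ _ = contradiction (trans (sym fS) (fSub-∉ S e₁)) λ ()
    ... | ∉∉ e₁ _ = contradiction (trans (sym fS) (fSub-∉ S e₁)) λ ()
    twoRows-fSub {S = S} {S′} {t} {c} {cs} {a} {b} fS φ≤ε _ _ | ∈∉ e₁ e₂ = begin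
      twoRows i a b (S ∷ t) (c ∷ cs)       ≡⟨ twoRows-∷ S t e₁ e₂ ⟩
      a ∷ twoRows i (b ⊔ c) (b ⊓ c) t cs   ≡⟨ cong (a ∷_) (comm-⊔-⊓ (λ x y → twoRows-comm t dead x y cs) b c) ⟩
      a ∷ twoRows i b c t cs               ≡⟨ twoRows-∷ S′ t e₁′ e₂′ ⟨
      twoRows i a b (S′ ∷ t) (c ∷ cs)      ∎
      where
      e₁′ = proj₁ (fSub-∈∉ fS e₁ e₂)
      e₂′ = proj₂ (fSub-∈∉ fS e₁ e₂)
      dead : fT _ i t ≡ nothing
      dead = fT-dead t (subst (φ t ≤_) (ε-∉ S e₂) φ≤ε)
    twoRows-fSub {S = S} {S′} {t} {c} {cs} {a} {b} fS φ≤ε fD hyp | ∈∈ e₁ e₂ = begin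
      twoRows i a b (S ∷ t) (c ∷ cs)       ≡⟨ twoRows-∷ S t e₁ e₂ ⟩
      a ∷ twoRows i b c t cs
        ≡⟨ cong₂ (λ u v → u ∷ twoRows i v c t cs) (m≥n⇒m⊔n≡m b≤a) (m≥n⇒m⊓n≡n b≤a) ⟨
      (a ⊔ b) ∷ twoRows i (a ⊓ b) c t cs   ≡⟨ twoRows-∷ S′ t e₁′ e₂′ ⟨
      twoRows i a b (S′ ∷ t) (c ∷ cs)      ∎
      where
      e₁′ = proj₁ (fSub-∈∈ fS e₁ e₂)
      e₂′ = proj₂ (fSub-∈∈ fS e₁ e₂)
      not-twice : ¬ AppliesTwice (fT _ i) (S ∷ t)
      not-twice (_ , _ , fD′ , fD″) with trans (sym fD) fD′
      ... | refl = contradiction (trans (sym (fT-stuck-after-∈∈ fS e₁ e₂ φ≤ε)) fD″) λ ()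
      b≤a : b ≤ a
      b≤a = fromInj₁ (⊥-elim ∘ not-twice) hyp

    -- b ≤ a is needed where f_i turns an ∈∈ column into an ∉∈ one.  Past an ∈∈ or ∉∈ column the labels
    -- may be unsorted, but then f_i applies twice to the remaining columns, which rules that case out.
    twoRows-fT : ∀ {k} {D D′ : RPD k n} {a b} cs → fT k i D ≡ just D′ → b ≤ a ⊎ AppliesTwice (fT k i) D →
      twoRows i a b D cs ≡ twoRows i a b D′ cs
    twoRows-fT {D = S ∷ t} (c ∷ cs) fD hyp with ε S <? φ t
    ... | no ε≮φ with map-≡-just (_∷ t) (fSub i S) (trans (sym (fT-∷-head S t (≮⇒≥ ε≮φ))) fD)
    ...   | _ , fS , refl = twoRows-fSub fS (≮⇒≥ ε≮φ) fD hyp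
    twoRows-fT {D = S ∷ t} {b = b} (c ∷ cs) fD hyp | yes ε<φ
      with map-≡-just (S ∷_) (fT _ i t) (trans (sym (fT-∷-tail S t ε<φ)) fD)
    ... | t′ , ft , refl with columnView S
    ...   | ∈∈ e₁ e₂ = twoRows-∷-cong S e₁ e₂ (twoRows-fT cs ft (inj₂ (twice-tail S t (ε-∈∈ e₁ e₂) ε<φ)))
    ...   | ∈∉ e₁ e₂ = twoRows-∷-cong S e₁ e₂ (twoRows-fT cs ft (inj₁ (m⊓n≤m⊔n b c)))
    ...   | ∉∈ e₁ e₂ = twoRows-∷-cong S e₁ e₂ (twoRows-fT cs ft (inj₂ (twice-tail S t (ε-∉∈ e₁ e₂) ε<φ)))
    ...   | ∉∉ e₁ e₂ = twoRows-∷-cong S e₁ e₂ (twoRows-fT cs ft (sorted-or-twice-∉∉ S t e₁ e₂ ft hyp))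

    sweep-fT : ∀ {m} {D D′ : RPD m n} → fT m i D ≡ just D′ → ∀ bs → sweep n D bs ≡ sweep n D′ bs
    sweep-fT {D = D} {D′} fD = sweep-extend (≤⇒≤′ i<n) above rows≤1+i
      where
      above : ∀ {r} → suc i < r → r ≤ n → row r D ≡ row r D′
      above 1+i<r _ = sym (fT-row fD (>⇒≢ (<-trans (n<1+n i) 1+i<r)) (>⇒≢ 1+i<r))
      below : ∀ {r} → 0 < r → r ≤ pred i → row r D ≡ row r D′
      below _ r≤i-1 = sym (fT-row fD (<⇒≢ r<i) (<⇒≢ (m<n⇒m<1+n r<i)))
        where
        r<i = m≤pred[n]⇒suc[m]≤n {{>-nonZero 1≤i}} r≤i-1
      rows≤1+i : ∀ bs → sweep (suc i) D bs ≡ sweep (suc i) D′ bs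
      rows≤1+i bs = begin
        sweep (suc i) D bs                       ≡⟨ sweep-twoRows 1≤i D bs ⟩
        sweep (pred i) D (twoRows i 0 0 D bs)    ≡⟨ cong (sweep (pred i) D) (twoRows-fT bs fD (inj₁ z≤n)) ⟩
        sweep (pred i) D (twoRows i 0 0 D′ bs)   ≡⟨ sweep-extend z≤′n below (λ _ → refl) _ ⟩
        sweep (pred i) D′ (twoRows i 0 0 D′ bs)  ≡⟨ sweep-twoRows 1≤i D′ bs ⟨
        sweep (suc i) D′ bs                      ∎

-- One-line notation

length-vecToList : ∀ {m} (v : Vec ℕ m) → length (vecToList v) ≡ m
length-vecToList []      = refl
length-vecToList (_ ∷ v) = cong suc (length-vecToList v)

lookupOr-++ˡ : ∀ {d} xs {ys k} → k < length xs → lookupOr d (xs ++ ys) k ≡ lookupOr d xs k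
lookupOr-++ˡ (x ∷ xs) {k = zero}  _   = refl
lookupOr-++ˡ (x ∷ xs) {k = suc k} k<∣xs∣ = lookupOr-++ˡ xs (s≤s⁻¹ k<∣xs∣)

lookupOr-vecToList-map : ∀ (f : ℕ → ℕ) {d d′ m} (v : Vec ℕ m) {k} → k < m →
  f (lookupOr d (vecToList v) k) ≡ lookupOr d′ (vecToList (Vec.map f v)) k
lookupOr-vecToList-map f (x ∷ v) {zero}  _   = refl
lookupOr-vecToList-map f (x ∷ v) {suc k} k<m = lookupOr-vecToList-map f v (s≤s⁻¹ k<m)

lookupOr-∈ : ∀ {d} xs {k} → k < length xs → lookupOr d xs k ∈ xs
lookupOr-∈ (x ∷ xs) {zero}  _        = here refl
lookupOr-∈ (x ∷ xs) {suc k} k<∣xs∣ = there (lookupOr-∈ xs (s≤s⁻¹ k<∣xs∣))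

lookupOr-≥ : ∀ {d} xs {k} → length xs ≤ k → lookupOr d xs k ≡ d
lookupOr-≥ []       _          = refl
lookupOr-≥ (x ∷ xs) (s≤s ∣xs∣≤k) = lookupOr-≥ xs ∣xs∣≤k

lookupOr-injective : ∀ {d d′ xs k k′} → Unique xs → k < length xs → k′ < length xs →
  lookupOr d xs k ≡ lookupOr d′ xs k′ → k ≡ k′
lookupOr-injective {xs = x ∷ xs} {zero}  {zero}   _          _ _ _ = refl
lookupOr-injective {xs = x ∷ xs} {zero}  {suc k′} (x∉ ∷ _) _ k′< eq =
  contradiction eq (All.lookup x∉ (lookupOr-∈ xs (s≤s⁻¹ k′<)))
lookupOr-injective {xs = x ∷ xs} {suc k} {zero}   (x∉ ∷ _) k< _ eq =
  contradiction (sym eq) (All.lookup x∉ (lookupOr-∈ xs (s≤s⁻¹ k<)))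
lookupOr-injective {xs = x ∷ xs} {suc k} {suc k′} (_ ∷ u) k< k′< eq =
  cong suc (lookupOr-injective u (s≤s⁻¹ k<) (s≤s⁻¹ k′<) eq)

∈⇒lookupOr : ∀ {x xs} → x ∈ xs → ∃ λ k → k < length xs × ∀ d → lookupOr d xs k ≡ x
∈⇒lookupOr (here refl) = zero , s≤s z≤n , λ _ → refl
∈⇒lookupOr (there x∈)  = let k , k< , eq = ∈⇒lookupOr x∈ in suc k , s≤s k< , eq

-- Collapsed top labels

collapse : ℕ → ℕ → ℕ
collapse n x with x ≤? n
... | yes _ = 0
... | no  _ = x

collapse-≤ : ∀ {n x} → x ≤ n → collapse n x ≡ 0
collapse-≤ {n} {x} x≤n with x ≤? n
... | yes _   = refl
... | no x≰n = contradiction x≤n x≰n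

collapse-> : ∀ {n x} → n < x → collapse n x ≡ x
collapse-> {n} {x} n<x with x ≤? n
... | yes x≤n = contradiction x≤n (<⇒≱ n<x)
... | no _    = refl

collapse-mono : ∀ {n} → collapse n Preserves _≤_ ⟶ _≤_
collapse-mono {n} {x} {y} x≤y with x ≤? n | y ≤? n
... | yes _   | _       = z≤n
... | no x≰n | yes y≤n = contradiction (≤-trans x≤y y≤n) x≰n
... | no _    | no _    = x≤y

collapse-injective-> : ∀ {n x y} → n < x → collapse n y ≡ collapse n x → y ≡ x
collapse-injective-> {n} {x} {y} n<x eq with ≤-<-connex y n
... | inj₁ y≤n = contradiction (trans (sym (collapse-≤ y≤n)) (trans eq (collapse-> n<x))) (<⇒≢ (≤-<-trans z≤n n<x))
... | inj₂ n<y = trans (sym (collapse-> n<y)) (trans eq (collapse-> n<x))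

sweep-rows : ∀ {m n k} (D : RPD m n) → k ≤ n → ∀ bs →
  Vec.map (collapse n) (proj₁ (rows k D bs)) ≡ sweep k D (Vec.map (collapse n) bs)
sweep-rows {k = zero} D _ bs = refl
sweep-rows {n = n} {suc k} D k<n bs = begin
  Vec.map (collapse n) (proj₁ (rows (suc k) D bs))
    ≡⟨ cong (Vec.map (collapse n) ∘ proj₁) (rows-suc k D bs) ⟩
  Vec.map (collapse n) (proj₁ (rows k D bs′))
    ≡⟨ sweep-rows D (<⇒≤ k<n) bs′ ⟩
  sweep k D (Vec.map (collapse n) bs′)
    ≡⟨ cong (sweep k D ∘ proj₁) (rowPass-map collapse-mono (suc k) (suc k) D bs) ⟨
  sweep k D (proj₁ (rowPass (suc k) (collapse n (suc k)) D (Vec.map (collapse n) bs)))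
    ≡⟨ cong (λ h → sweep k D (proj₁ (rowPass (suc k) h D (Vec.map (collapse n) bs)))) (collapse-≤ k<n) ⟩
  sweep (suc k) D (Vec.map (collapse n) bs)
    ∎
  where
  bs′ = proj₁ (rowPass (suc k) (suc k) D bs)

collapse-initBottoms : ∀ {n n′ m} → n ≤ n′ → Vec.map (collapse n) (initBottoms n′ m) ≡ initBottoms n′ m
collapse-initBottoms {m = zero}  _    = refl
collapse-initBottoms {m = suc m} n≤n′ = cong₂ _∷_ (collapse-> (s≤s n≤n′)) (collapse-initBottoms (m≤n⇒m≤1+n n≤n′))

collapsedTops : ∀ {m n} → RPD m n → Vec ℕ m
collapsedTops {m} {n} D = sweep n D (initBottoms n m)

collapsedTops-rows : ∀ {m n} (D : RPD m n) →
  collapsedTops D ≡ Vec.map (collapse n) (proj₁ (rows n D (initBottoms n m)))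
collapsedTops-rows {m} {n} D = begin
  sweep n D (initBottoms n m)                             ≡⟨ cong (sweep n D) (collapse-initBottoms ≤-refl) ⟨
  sweep n D (Vec.map (collapse n) (initBottoms n m))      ≡⟨ sweep-rows D ≤-refl (initBottoms n m) ⟨
  Vec.map (collapse n) (proj₁ (rows n D (initBottoms n m))) ∎

collapsedTops-component : ∀ {m n} {D D′ : RPD m n} → SameComponent D D′ → collapsedTops D ≡ collapsedTops D′
collapsedTops-component = gfold isEquivalence collapsedTops edge
  where
  edge : ∀ {m n} {D D′ : RPD m n} → Edge D D′ → collapsedTops D ≡ collapsedTops D′
  edge (i , 1≤i , i<n , fD) = sweep-fT i 1≤i i<n fD _

collapse-σ : ∀ {m n} (D : RPD m n) {k} → k < m →
  collapse n (σ D (suc k)) ≡ lookupOr 0 (vecToList (collapsedTops D)) k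
collapse-σ {m} {n} D {k} k<m = begin
  collapse n (lookupOr (suc k) (oneLine D) k)
    ≡⟨ cong (λ xs → collapse n (lookupOr (suc k) xs k)) (oneLine-rows D) ⟩
  collapse n (lookupOr (suc k) (vecToList tops ++ rights) k)
    ≡⟨ cong (collapse n) (lookupOr-++ˡ (vecToList tops) (subst (k <_) (sym (length-vecToList tops)) k<m)) ⟩
  collapse n (lookupOr (suc k) (vecToList tops) k)
    ≡⟨ lookupOr-vecToList-map (collapse n) tops k<m ⟩
  lookupOr 0 (vecToList (Vec.map (collapse n) tops)) k
    ≡⟨ cong (λ v → lookupOr 0 (vecToList v) k) (collapsedTops-rows D) ⟨
  lookupOr 0 (vecToList (collapsedTops D)) k
    ∎
  where
  tops = proj₁ (rows n D (initBottoms n m))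
  rights = proj₂ (rows n D (initBottoms n m))

collapse-σ-component : ∀ {m n} {D D′ : RPD m n} → SameComponent D D′ → ∀ {p} → p ≤ m →
  collapse n (σ D p) ≡ collapse n (σ D′ p)
collapse-σ-component _ {zero} _ = refl
collapse-σ-component {n = n} {D} {D′} D~D′ {suc k} k<m = begin
  collapse n (σ D (suc k))
    ≡⟨ collapse-σ D k<m ⟩
  lookupOr 0 (vecToList (collapsedTops D)) k
    ≡⟨ cong (λ v → lookupOr 0 (vecToList v) k) (collapsedTops-component D~D′) ⟩
  lookupOr 0 (vecToList (collapsedTops D′)) k
    ≡⟨ collapse-σ D′ k<m ⟨
  collapse n (σ D′ (suc k))
    ∎

-- Permutations of [1, N]

InRange : ℕ → ℕ → Set
InRange N x = 1 ≤ x × x ≤ N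

record IsPermutationOf (N : ℕ) (f : ℕ → ℕ) : Set where
  field
    maps-into   : ∀ {x} → InRange N x → InRange N (f x)
    injective   : ∀ {x y} → InRange N x → InRange N y → f x ≡ f y → x ≡ y
    surjective  : ∀ {y} → InRange N y → ∃ λ x → InRange N x × f x ≡ y
    fixes-zero  : f 0 ≡ 0
    fixes-above : ∀ {x} → N < x → f x ≡ x

isPermutation-∘ : ∀ {N f g} → IsPermutationOf N f → IsPermutationOf N g → IsPermutationOf N (f ∘ g)
isPermutation-∘ {N} {f} {g} F G = record
  { maps-into   = F.maps-into ∘ G.maps-into
  ; injective   = λ x∈ y∈ → G.injective x∈ y∈ ∘ F.injective (G.maps-into x∈) (G.maps-into y∈)
  ; surjective  = surjective
  ; fixes-zero  = trans (cong f G.fixes-zero) F.fixes-zero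
  ; fixes-above = λ N<x → trans (cong f (G.fixes-above N<x)) (F.fixes-above N<x)
  }
  where
  module F = IsPermutationOf F
  module G = IsPermutationOf G
  surjective : ∀ {y} → InRange N y → ∃ λ x → InRange N x × f (g x) ≡ y
  surjective y∈ = let z , z∈ , fz≡y = F.surjective y∈ ; x , x∈ , gx≡z = G.surjective z∈ in
                  x , x∈ , trans (cong f gx≡z) fz≡y

isPermutation-≗ : ∀ {N f g} → f ≗ g → IsPermutationOf N f → IsPermutationOf N g
isPermutation-≗ {N} {f} {g} f≗g F = record
  { maps-into   = λ {x} x∈ → subst (InRange N) (f≗g x) (F.maps-into x∈)
  ; injective   = λ {x} {y} x∈ y∈ gx≡gy → F.injective x∈ y∈ (trans (f≗g x) (trans gx≡gy (sym (f≗g y))))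
  ; surjective  = λ y∈ → let x , x∈ , fx≡y = F.surjective y∈ in x , x∈ , trans (sym (f≗g x)) fx≡y
  ; fixes-zero  = trans (sym (f≗g 0)) F.fixes-zero
  ; fixes-above = λ {x} N<x → trans (sym (f≗g x)) (F.fixes-above N<x)
  }
  where
  module F = IsPermutationOf F

module _ {n N : ℕ} {f : ℕ → ℕ} (n≤N : n ≤ N) (F : IsPermutationOf n f) where

  private
    module F = IsPermutationOf F

    small : ∀ {x} → InRange N x → x ≤ n → InRange n x
    small (1≤x , _) x≤n = 1≤x , x≤n

    small≢large : ∀ {x y} → InRange N x → x ≤ n → n < y → f x ≢ f y
    small≢large x∈ x≤n n<y fx≡fy =
      <⇒≱ n<y (subst (_≤ n) (trans fx≡fy (F.fixes-above n<y)) (proj₂ (F.maps-into (small x∈ x≤n))))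

  isPermutation-≤ : IsPermutationOf N f
  isPermutation-≤ = record
    { maps-into   = maps-into
    ; injective   = injective
    ; surjective  = surjective
    ; fixes-zero  = F.fixes-zero
    ; fixes-above = F.fixes-above ∘ ≤-<-trans n≤N
    }
    where
    maps-into : ∀ {x} → InRange N x → InRange N (f x)
    maps-into {x} x∈ with ≤-<-connex x n
    ... | inj₁ x≤n = Product.map₂ (λ fx≤n → ≤-trans fx≤n n≤N) (F.maps-into (small x∈ x≤n))
    ... | inj₂ n<x = subst (InRange N) (sym (F.fixes-above n<x)) x∈
    injective : ∀ {x y} → InRange N x → InRange N y → f x ≡ f y → x ≡ y
    injective {x} {y} x∈ y∈ fx≡fy with ≤-<-connex x n | ≤-<-connex y n
    ... | inj₁ x≤n | inj₁ y≤n = F.injective (small x∈ x≤n) (small y∈ y≤n) fx≡fy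
    ... | inj₁ x≤n | inj₂ n<y = contradiction fx≡fy (small≢large x∈ x≤n n<y)
    ... | inj₂ n<x | inj₁ y≤n = contradiction (sym fx≡fy) (small≢large y∈ y≤n n<x)
    ... | inj₂ n<x | inj₂ n<y = trans (sym (F.fixes-above n<x)) (trans fx≡fy (F.fixes-above n<y))
    surjective : ∀ {y} → InRange N y → ∃ λ x → InRange N x × f x ≡ y
    surjective {y} y∈ with ≤-<-connex y n
    ... | inj₁ y≤n = let x , (1≤x , x≤n) , fx≡y = F.surjective (small y∈ y≤n) in
                     x , (1≤x , ≤-trans x≤n n≤N) , fx≡y
    ... | inj₂ n<y = y , y∈ , F.fixes-above n<y

collapse-isPermutation : ∀ {n f} → IsPermutationOf n f → ∀ x → collapse n (f x) ≡ collapse n x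
collapse-isPermutation {n} F x with ≤-<-connex x n
... | inj₂ n<x = cong (collapse n) (IsPermutationOf.fixes-above F n<x)
collapse-isPermutation {n} F zero    | inj₁ _   = cong (collapse n) (IsPermutationOf.fixes-zero F)
collapse-isPermutation {n} F (suc k) | inj₁ x≤n =
  trans (collapse-≤ (proj₂ (IsPermutationOf.maps-into F (s≤s z≤n , x≤n)))) (sym (collapse-≤ x≤n))

module _ {n : ℕ} (π : Permutation′ n) where

  emb-< : ∀ {k} (k<n : k < n) → emb π (suc k) ≡ suc (toℕ (π ⟨$⟩ʳ fromℕ< k<n))
  emb-< {k} k<n with k <? n
  ... | yes k<n′ = cong (λ p → suc (toℕ (π ⟨$⟩ʳ fromℕ< p))) (<-irrelevant k<n′ k<n)
  ... | no k≮n   = contradiction k<n k≮n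

  emb-≥ : ∀ {k} → n ≤ k → emb π (suc k) ≡ suc k
  emb-≥ {k} n≤k with k <? n
  ... | yes k<n = contradiction n≤k (<⇒≱ k<n)
  ... | no _    = refl

  emb-injective : ∀ {x y} → InRange n x → InRange n y → emb π x ≡ emb π y → x ≡ y
  emb-injective {suc k} {suc k′} (_ , k<n) (_ , k′<n) eq rewrite emb-< k<n | emb-< k′<n = cong suc (begin
    k                                  ≡⟨ toℕ-fromℕ< k<n ⟨
    toℕ (fromℕ< k<n)                   ≡⟨ cong toℕ (inverseˡ π) ⟨
    toℕ (π ⟨$⟩ˡ (π ⟨$⟩ʳ fromℕ< k<n))    ≡⟨ cong (λ j → toℕ (π ⟨$⟩ˡ j)) (toℕ-injective (suc-injective eq)) ⟩
    toℕ (π ⟨$⟩ˡ (π ⟨$⟩ʳ fromℕ< k′<n))   ≡⟨ cong toℕ (inverseˡ π) ⟩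
    toℕ (fromℕ< k′<n)                  ≡⟨ toℕ-fromℕ< k′<n ⟩
    k′                                 ∎)

  emb-surjective : ∀ {y} → InRange n y → ∃ λ x → InRange n x × emb π x ≡ y
  emb-surjective {suc k} (_ , k<n) = suc (toℕ j) , (s≤s z≤n , toℕ<n j) , (begin
    emb π (suc (toℕ j))                    ≡⟨ emb-< (toℕ<n j) ⟩
    suc (toℕ (π ⟨$⟩ʳ fromℕ< (toℕ<n j)))    ≡⟨ cong (λ j′ → suc (toℕ (π ⟨$⟩ʳ j′))) (fromℕ<-toℕ j (toℕ<n j)) ⟩
    suc (toℕ (π ⟨$⟩ʳ j))                   ≡⟨ cong (suc ∘ toℕ) (inverseʳ π) ⟩
    suc (toℕ (fromℕ< k<n))                 ≡⟨ cong suc (toℕ-fromℕ< k<n) ⟩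
    suc k                                  ∎)
    where
    j = π ⟨$⟩ˡ fromℕ< k<n

  emb-isPermutation : IsPermutationOf n (emb π)
  emb-isPermutation = record
    { maps-into   = maps-into
    ; injective   = emb-injective
    ; surjective  = emb-surjective
    ; fixes-zero  = refl
    ; fixes-above = fixes-above
    }
    where
    maps-into : ∀ {x} → InRange n x → InRange n (emb π x)
    maps-into {suc k} (_ , k<n) rewrite emb-< k<n = s≤s z≤n , toℕ<n _
    fixes-above : ∀ {x} → n < x → emb π x ≡ x
    fixes-above {suc k} n<1+k = emb-≥ (s≤s⁻¹ n<1+k)

module _ {m n : ℕ} {f g : ℕ → ℕ} (F : IsPermutationOf n f)
         (g-≤ : ∀ {x} → x ≤ m → g x ≡ x) (g-> : ∀ {x} → m < x → g x ≡ m + f (x ∸ m)) where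

  private
    module F = IsPermutationOf F

    ∸-inRange : ∀ {x} → m < x → x ≤ m + n → InRange n (x ∸ m)
    ∸-inRange {x} m<x x≤m+n = m<n⇒0<n∸m m<x , m≤n+o⇒m∸n≤o x m x≤m+n

    +-inRange : ∀ {z} → InRange n z → m < m + z × m + z ≤ m + n
    +-inRange {z} (1≤z , z≤n′) = subst (_≤ m + z) (+-comm m 1) (+-monoʳ-≤ m 1≤z) , +-monoʳ-≤ m z≤n′

    g-large : ∀ {x} → m < x → x ≤ m + n → m < g x × g x ≤ m + n
    g-large m<x x≤m+n =
      subst (λ v → m < v × v ≤ m + n) (sym (g-> m<x)) (+-inRange (F.maps-into (∸-inRange m<x x≤m+n)))

  shift-maps-into : ∀ {x} → InRange (m + n) x → InRange (m + n) (g x)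
  shift-maps-into {x} x∈@(_ , x≤m+n) with ≤-<-connex x m
  ... | inj₁ x≤m = subst (InRange (m + n)) (sym (g-≤ x≤m)) x∈
  ... | inj₂ m<x = Product.map₁ (≤-trans (s≤s z≤n)) (g-large m<x x≤m+n)

  shift-injective : ∀ {x y} → InRange (m + n) x → InRange (m + n) y → g x ≡ g y → x ≡ y
  shift-injective {x} {y} (_ , x≤m+n) (_ , y≤m+n) gx≡gy with ≤-<-connex x m | ≤-<-connex y m
  ... | inj₁ x≤m | inj₁ y≤m = trans (sym (g-≤ x≤m)) (trans gx≡gy (g-≤ y≤m))
  ... | inj₁ x≤m | inj₂ m<y =
    contradiction (subst (_≤ m) (trans (sym (g-≤ x≤m)) gx≡gy) x≤m) (<⇒≱ (proj₁ (g-large m<y y≤m+n)))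
  ... | inj₂ m<x | inj₁ y≤m =
    contradiction (subst (_≤ m) (trans (sym (g-≤ y≤m)) (sym gx≡gy)) y≤m) (<⇒≱ (proj₁ (g-large m<x x≤m+n)))
  ... | inj₂ m<x | inj₂ m<y = begin
    x              ≡⟨ m+[n∸m]≡n (<⇒≤ m<x) ⟨
    m + (x ∸ m)    ≡⟨ cong (m +_) (F.injective (∸-inRange m<x x≤m+n) (∸-inRange m<y y≤m+n) f-eq) ⟩
    m + (y ∸ m)    ≡⟨ m+[n∸m]≡n (<⇒≤ m<y) ⟩
    y              ∎
    where
    f-eq : f (x ∸ m) ≡ f (y ∸ m)
    f-eq = +-cancelˡ-≡ m _ _ (trans (sym (g-> m<x)) (trans gx≡gy (g-> m<y)))

  shift-surjective : ∀ {y} → InRange (m + n) y → ∃ λ x → InRange (m + n) x × g x ≡ y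
  shift-surjective {y} y∈@(_ , y≤m+n) with ≤-<-connex y m
  ... | inj₁ y≤m = y , y∈ , g-≤ y≤m
  ... | inj₂ m<y =
    let z , z∈ , fz≡y-m = F.surjective (∸-inRange m<y y≤m+n) ; m<m+z , m+z≤m+n = +-inRange z∈ in
    m + z , (≤-trans (s≤s z≤n) m<m+z , m+z≤m+n) , (begin
      g (m + z)            ≡⟨ g-> m<m+z ⟩
      m + f (m + z ∸ m)    ≡⟨ cong (λ z′ → m + f z′) (m+n∸m≡n m z) ⟩
      m + f z              ≡⟨ cong (m +_) fz≡y-m ⟩
      m + (y ∸ m)          ≡⟨ m+[n∸m]≡n (<⇒≤ m<y) ⟩
      y                    ∎)

  shift-fixes-above : ∀ {x} → m + n < x → g x ≡ x
  shift-fixes-above {x} m+n<x = begin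
    g x               ≡⟨ g-> m<x ⟩
    m + f (x ∸ m)     ≡⟨ cong (m +_) (F.fixes-above n<x∸m) ⟩
    m + (x ∸ m)       ≡⟨ m+[n∸m]≡n (<⇒≤ m<x) ⟩
    x                 ∎
    where
    m<x = ≤-<-trans (m≤m+n m n) m+n<x
    n<x∸m = subst (_< x ∸ m) (m+n∸m≡n m n) (∸-monoˡ-< m+n<x (m≤m+n m n))

  shift-isPermutation : IsPermutationOf (m + n) g
  shift-isPermutation = record
    { maps-into   = shift-maps-into
    ; injective   = shift-injective
    ; surjective  = shift-surjective
    ; fixes-zero  = g-≤ z≤n
    ; fixes-above = shift-fixes-above
    }

module _ (m : ℕ) {n : ℕ} (π : Permutation′ n) where

  oneTimes-≤ : ∀ {x} → x ≤ m → oneTimes m π x ≡ x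
  oneTimes-≤ {x} x≤m with m <? x
  ... | yes m<x = contradiction x≤m (<⇒≱ m<x)
  ... | no _    = refl

  oneTimes-> : ∀ {x} → m < x → oneTimes m π x ≡ m + emb π (x ∸ m)
  oneTimes-> {x} m<x with m <? x
  ... | yes _   = refl
  ... | no m≮x = contradiction m<x m≮x

  oneTimes-isPermutation : IsPermutationOf (m + n) (oneTimes m π)
  oneTimes-isPermutation = shift-isPermutation (emb-isPermutation π) oneTimes-≤ oneTimes->

record Enumerates (N : ℕ) (xs : List ℕ) : Set where
  field
    unique    : Unique xs
    length≡   : length xs ≡ N
    ∈⇒inRange : ∀ {x} → x ∈ xs → InRange N x
    inRange⇒∈ : ∀ {x} → InRange N x → x ∈ xs

enumerates-↭ : ∀ {N xs ys} → xs ↭ ys → Enumerates N xs → Enumerates N ys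
enumerates-↭ xs↭ys E = record
  { unique    = Unique-resp-↭ (↭⇒↭ₛ xs↭ys) E.unique
  ; length≡   = trans (sym (↭-length xs↭ys)) E.length≡
  ; ∈⇒inRange = E.∈⇒inRange ∘ ∈-resp-↭ (↭-sym xs↭ys)
  ; inRange⇒∈ = ∈-resp-↭ xs↭ys ∘ E.inRange⇒∈
  }
  where
  module E = Enumerates E

fromOneLine : List ℕ → ℕ → ℕ
fromOneLine xs zero    = zero
fromOneLine xs (suc k) = lookupOr (suc k) xs k

fromOneLine-isPermutation : ∀ {N xs} → Enumerates N xs → IsPermutationOf N (fromOneLine xs)
fromOneLine-isPermutation {N} {xs} E = record
  { maps-into   = maps-into
  ; injective   = injective
  ; surjective  = surjective
  ; fixes-zero  = refl
  ; fixes-above = fixes-above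
  }
  where
  module E = Enumerates E
  bounded : ∀ {k} → suc k ≤ N → k < length xs
  bounded = subst (_ <_) (sym E.length≡)
  maps-into : ∀ {x} → InRange N x → InRange N (fromOneLine xs x)
  maps-into {suc k} (_ , k<N) = E.∈⇒inRange (lookupOr-∈ xs (bounded k<N))
  injective : ∀ {x y} → InRange N x → InRange N y → fromOneLine xs x ≡ fromOneLine xs y → x ≡ y
  injective {suc k} {suc k′} (_ , k<N) (_ , k′<N) eq =
    cong suc (lookupOr-injective E.unique (bounded k<N) (bounded k′<N) eq)
  surjective : ∀ {y} → InRange N y → ∃ λ x → InRange N x × fromOneLine xs x ≡ y
  surjective y∈ = let k , k< , eq = ∈⇒lookupOr (E.inRange⇒∈ y∈) in
    suc k , (s≤s z≤n , subst (k <_) E.length≡ k<) , eq (suc k)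
  fixes-above : ∀ {x} → N < x → fromOneLine xs x ≡ x
  fixes-above {suc k} N<1+k = lookupOr-≥ xs (subst (_≤ k) (sym E.length≡) (s≤s⁻¹ N<1+k))

∈-initBottoms⁻ : ∀ {x n m} → x ∈ vecToList (initBottoms n m) → n < x × x ≤ n + m
∈-initBottoms⁻ {n = n} {suc m} (here refl) = ≤-refl , subst (suc n ≤_) (sym (+-suc n m)) (s≤s (m≤m+n n m))
∈-initBottoms⁻ {x} {n} {suc m} (there x∈) =
  Product.map (<-trans (n<1+n n)) (subst (x ≤_) (sym (+-suc n m))) (∈-initBottoms⁻ x∈)

∈-initBottoms⁺ : ∀ {x n m} → n < x → x ≤ n + m → x ∈ vecToList (initBottoms n m)
∈-initBottoms⁺ {x} {n} {zero}  n<x x≤n+0 = contradiction (subst (x ≤_) (+-identityʳ n) x≤n+0) (<⇒≱ n<x)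
∈-initBottoms⁺ {x} {n} {suc m} n<x x≤n+1+m with x ≟ suc n
... | yes refl = here refl
... | no x≢1+n = there (∈-initBottoms⁺ (≤∧≢⇒< n<x (x≢1+n ∘ sym)) (subst (x ≤_) (+-suc n m) x≤n+1+m))

initBottoms-unique : ∀ n m → Unique (vecToList (initBottoms n m))
initBottoms-unique n zero    = []
initBottoms-unique n (suc m) =
  All.tabulate (λ x∈ → <⇒≢ (proj₁ (∈-initBottoms⁻ x∈))) ∷ initBottoms-unique (suc n) m

enteringLabels-enumerate : ∀ m n → Enumerates (m + n) (enteringLabels m n)
enteringLabels-enumerate m n = record
  { unique    = Unique.++⁺ (initBottoms-unique n m)
                  (Unique.applyDownFrom⁺₁ suc n (λ j<i _ → <⇒≢ j<i ∘ sym ∘ suc-injective))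
                  (λ (x∈ , x∈′) → <⇒≱ (proj₁ (∈-initBottoms⁻ x∈)) (proj₂ (downFrom-inRange x∈′)))
  ; length≡   = begin
      length (vecToList (initBottoms n m) ++ applyDownFrom suc n)
        ≡⟨ List.length-++ (vecToList (initBottoms n m)) ⟩
      length (vecToList (initBottoms n m)) + length (applyDownFrom suc n)
        ≡⟨ cong₂ _+_ (length-vecToList (initBottoms n m)) (List.length-applyDownFrom suc n) ⟩
      m + n
        ∎
  ; ∈⇒inRange = ∈⇒inRange
  ; inRange⇒∈ = inRange⇒∈
  }
  where
  downFrom-inRange : ∀ {x} → x ∈ applyDownFrom suc n → InRange n x
  downFrom-inRange x∈ with ∈-applyDownFrom⁻ suc x∈
  ... | i , i<n , refl = s≤s z≤n , i<n
  ∈⇒inRange : ∀ {x} → x ∈ enteringLabels m n → InRange (m + n) x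
  ∈⇒inRange {x} x∈ with ∈-++⁻ (vecToList (initBottoms n m)) x∈
  ... | inj₁ x∈₁ = let n<x , x≤n+m = ∈-initBottoms⁻ x∈₁ in
                   ≤-trans (s≤s z≤n) n<x , subst (x ≤_) (+-comm n m) x≤n+m
  ... | inj₂ x∈₂ = Product.map₂ (λ x≤n → ≤-trans x≤n (m≤n+m n m)) (downFrom-inRange x∈₂)
  inRange⇒∈ : ∀ {x} → InRange (m + n) x → x ∈ enteringLabels m n
  inRange⇒∈ {suc k} (_ , x≤m+n) with ≤-<-connex (suc k) n
  ... | inj₁ k<n = ∈-++⁺ʳ (vecToList (initBottoms n m)) (∈-applyDownFrom⁺ suc k<n)
  ... | inj₂ n<x = ∈-++⁺ˡ (∈-initBottoms⁺ n<x (subst (suc k ≤_) (+-comm m n) x≤m+n))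

σ-isPermutation : ∀ {m n} (D : RPD m n) → IsPermutationOf (m + n) (σ D)
σ-isPermutation {m} {n} D =
  isPermutation-≗ fromOneLine≗σ
    (fromOneLine-isPermutation (enumerates-↭ (↭-sym (oneLine-↭ D)) (enteringLabels-enumerate m n)))
  where
  fromOneLine≗σ : fromOneLine (oneLine D) ≗ σ D
  fromOneLine≗σ zero    = refl
  fromOneLine≗σ (suc k) = refl

-- Uniqueness of σ̄

module _ (m n : ℕ) where

  record Normalised (w : ℕ → ℕ) : Set where
    field
      permutation        : IsPermutationOf (m + n) w
      inverse-descending : ∀ p p′ → 1 ≤ p → p ≤ m + n → 1 ≤ p′ → p′ ≤ m + n →
                           1 ≤ w p → w p < w p′ → w p′ ≤ n → p′ < p
      descending-after   : ∀ i i′ → 1 ≤ i → i < i′ → i′ ≤ n → w (m + i′) < w (m + i)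

    open IsPermutationOf permutation public

    descending-above : ∀ {q q′} → m < q → q < q′ → q′ ≤ m + n → w q′ < w q
    descending-above {q} {q′} m<q q<q′ q′≤m+n =
      subst₂ (λ a b → w a < w b) (m+[n∸m]≡n (<⇒≤ (<-trans m<q q<q′))) (m+[n∸m]≡n (<⇒≤ m<q))
        (descending-after (q ∸ m) (q′ ∸ m) (m<n⇒0<n∸m m<q) (∸-monoˡ-< q<q′ (<⇒≤ m<q))
                          (m≤n+o⇒m∸n≤o q′ m q′≤m+n))

  Keeps : (ℕ → ℕ) → (ℕ → ℕ) → ℕ → Set
  Keeps w w′ v = ∀ {q} → InRange (m + n) q → w q ≡ v → w′ q ≡ v

  keeps-above-range : ∀ {w w′ v} → IsPermutationOf (m + n) w → m + n < v → Keeps w w′ v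
  keeps-above-range W m+n<v q∈ wq≡v =
    contradiction (subst (_≤ m + n) wq≡v (proj₂ (IsPermutationOf.maps-into W q∈))) (<⇒≱ m+n<v)

  moved-below : ∀ {w w′ v q q′} → IsPermutationOf (m + n) w′ → (∀ {u} → v < u → Keeps w′ w u) →
    InRange (m + n) q → InRange (m + n) q′ → q ≢ q′ → w q ≡ v → w′ q′ ≡ v → w′ q < v
  moved-below {w′ = w′} {v} {q} W′ above q∈ q′∈ q≢q′ wq≡v w′q′≡v with <-cmp (w′ q) v
  ... | tri< w′q<v _ _ = w′q<v
  ... | tri≈ _ w′q≡v _ = contradiction (IsPermutationOf.injective W′ q∈ q′∈ (trans w′q≡v (sym w′q′≡v))) q≢q′
  ... | tri> _ _ v<w′q = contradiction (trans (sym wq≡v) (above v<w′q q∈ refl)) (<⇒≢ v<w′q)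

  beyond-m : ∀ (f g : ℕ → ℕ) {q v} → (∀ p → p ≤ m → collapse n (f p) ≡ collapse n (g p)) →
    n < v → f q ≡ v → g q < v → m < q
  beyond-m f g {q} agree n<v fq≡v gq<v with ≤-<-connex q m
  ... | inj₂ m<q = m<q
  ... | inj₁ q≤m =
    contradiction (collapse-injective-> n<v (trans (sym (agree q q≤m)) (cong (collapse n) fq≡v))) (<⇒≢ gq<v)

  module _ {w w′} (W : Normalised w) (W′ : Normalised w′)
           (agree : ∀ p → p ≤ m → collapse n (w p) ≡ collapse n (w′ p)) where

    private
      module W = Normalised W
      module W′ = Normalised W′

    no-exchange : ∀ {q q′ v} → InRange (m + n) q → InRange (m + n) q′ →
      w q ≡ v → w′ q′ ≡ v → w′ q < v → w q′ < v → ⊥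
    no-exchange {q} {q′} {v} q∈@(1≤q , q≤m+n) q′∈@(1≤q′ , q′≤m+n) wq≡v w′q′≡v w′q<v wq′<v
      with ≤-<-connex v n
    ... | inj₁ v≤n = <-asym q′<q q<q′
      where
      q′<q = W′.inverse-descending q q′ 1≤q q≤m+n 1≤q′ q′≤m+n (proj₁ (W′.maps-into q∈))
               (subst (w′ q <_) (sym w′q′≡v) w′q<v) (subst (_≤ n) (sym w′q′≡v) v≤n)
      q<q′ = W.inverse-descending q′ q 1≤q′ q′≤m+n 1≤q q≤m+n (proj₁ (W.maps-into q′∈))
               (subst (w q′ <_) (sym wq≡v) wq′<v) (subst (_≤ n) (sym wq≡v) v≤n)
    ... | inj₂ n<v with <-cmp q q′
    ...   | tri< q<q′ _ _ = <-asym w′q<v (subst (_< w′ q) w′q′≡v (W′.descending-above m<q q<q′ q′≤m+n))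
      where
      m<q = beyond-m w w′ agree n<v wq≡v w′q<v
    ...   | tri≈ _ refl _ = <-irrefl wq≡v wq′<v
    ...   | tri> _ _ q′<q = <-asym wq′<v (subst (_< w q′) wq≡v (W.descending-above m<q′ q′<q q≤m+n))
      where
      m<q′ = beyond-m w′ w (λ p p≤m → sym (agree p p≤m)) n<v w′q′≡v wq′<v

    keeps : ∀ {v} → (∀ {u} → v < u → Keeps w w′ u) → (∀ {u} → v < u → Keeps w′ w u) → Keeps w w′ v
    keeps {v} above above′ {q} q∈ wq≡v with W′.surjective (subst (InRange (m + n)) wq≡v (W.maps-into q∈))
    ... | q′ , q′∈ , w′q′≡v with q ≟ q′
    ...   | yes refl   = w′q′≡v
    ...   | no q≢q′ = ⊥-elim (no-exchange q∈ q′∈ wq≡v w′q′≡v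
                        (moved-below W′.permutation above′ q∈ q′∈ q≢q′ wq≡v w′q′≡v)
                        (moved-below W.permutation above q′∈ q∈ (q≢q′ ∘ sym) w′q′≡v wq≡v))

  normalised-unique : ∀ {w w′} → Normalised w → Normalised w′ →
    (∀ p → p ≤ m → collapse n (w p) ≡ collapse n (w′ p)) → ∀ x → w x ≡ w′ x
  normalised-unique W W′ agree x with ≤-<-connex x (m + n)
  ... | inj₂ m+n<x = trans (Normalised.fixes-above W m+n<x) (sym (Normalised.fixes-above W′ m+n<x))
  normalised-unique W W′ agree zero | inj₁ _ = trans (Normalised.fixes-zero W) (sym (Normalised.fixes-zero W′))
  normalised-unique {w} {w′} W W′ agree (suc k) | inj₁ x≤m+n =
    sym (proj₁ (kept (m + n) (m≤n+m (m + n) (w (suc k)))) (s≤s z≤n , x≤m+n) refl)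
    where
    both : ∀ {v} → (∀ {u} → v < u → Keeps w w′ u × Keeps w′ w u) → Keeps w w′ v × Keeps w′ w v
    both above = keeps W W′ agree (λ v<u → proj₁ (above v<u)) (λ v<u → proj₂ (above v<u))
               , keeps W′ W (λ p p≤m → sym (agree p p≤m))
                   (λ v<u → proj₂ (above v<u)) (λ v<u → proj₁ (above v<u))
    kept : ∀ d {v} → m + n ≤ v + d → Keeps w w′ v × Keeps w′ w v
    kept zero    {v} m+n≤v+0 = both λ v<u →
      let m+n<u = ≤-<-trans (subst (m + n ≤_) (+-identityʳ v) m+n≤v+0) v<u in
      keeps-above-range {w′ = w′} (Normalised.permutation W) m+n<u
      , keeps-above-range {w′ = w} (Normalised.permutation W′) m+n<u
    kept (suc d) {v} m+n≤v+1+d = both λ {u} v<u →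
      kept d (≤-trans m+n≤v+1+d (subst (_≤ u + d) (sym (+-suc v d)) (+-monoˡ-≤ d v<u)))

isSigmaBar⇒normalised : ∀ {m n} {D : RPD m n} {w} → IsSigmaBar D w → Normalised m n w
isSigmaBar⇒normalised {m} {n} {D} ((u , v , w≗) , inverse-descending , descending-after) = record
  { permutation        = isPermutation-≗ (sym ∘ w≗)
                           (isPermutation-∘ (isPermutation-≤ (m≤n+m n m) (emb-isPermutation u))
                             (isPermutation-∘ (σ-isPermutation D) (oneTimes-isPermutation m (flip v))))
  ; inverse-descending = inverse-descending
  ; descending-after   = descending-after
  }

isSigmaBar-collapse : ∀ {m n} {D : RPD m n} {w} → IsSigmaBar D w → ∀ {p} → p ≤ m →
  collapse n (w p) ≡ collapse n (σ D p)
isSigmaBar-collapse {m} {n} {D} {w} ((u , v , w≗) , _) {p} p≤m = begin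
  collapse n (w p)                   ≡⟨ cong (collapse n) (w≗ p) ⟩
  collapse n (emb u (σ D p′))        ≡⟨ collapse-isPermutation (emb-isPermutation u) (σ D p′) ⟩
  collapse n (σ D p′)                ≡⟨ cong (collapse n ∘ σ D) (oneTimes-≤ m (flip v) p≤m) ⟩
  collapse n (σ D p)                 ∎
  where
  p′ = oneTimes m (flip v) p

corollary4p7 : (m n : ℕ) (D₁ D₂ : RPD m n) → SameComponent D₁ D₂ →
    (w₁ w₂ : ℕ → ℕ) → IsSigmaBar D₁ w₁ → IsSigmaBar D₂ w₂ →
    ∀ x → w₁ x ≡ w₂ x
corollary4p7 m n D₁ D₂ D₁~D₂ w₁ w₂ w₁-bar w₂-bar =
  normalised-unique m n (isSigmaBar⇒normalised w₁-bar) (isSigmaBar⇒normalised w₂-bar) λ p p≤m → begin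
    collapse n (w₁ p)     ≡⟨ isSigmaBar-collapse w₁-bar p≤m ⟩
    collapse n (σ D₁ p)   ≡⟨ collapse-σ-component D₁~D₂ p≤m ⟩
    collapse n (σ D₂ p)   ≡⟨ isSigmaBar-collapse w₂-bar p≤m ⟨
    collapse n (w₂ p)     ∎
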